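{- For every base $\mathscr B$ and IPL formulas $\phi,\psi,\chi$: if $\Vdash^{\ast}_{\mathscr B}\phi\land\psi$ and $\phi,\psi\Vdash^{\ast}_{\mathscr B}\chi$, then $\Vdash^{\ast}_{\mathscr B}\chi$.
   Context: Fix a denumerable set $\mathbb{A}$ of atoms. IPL formulas are built from atoms and $\bot$ using $\land,\lor,\to$. An atomic rule has the form $(Q_1\triangleright q_1,\dots,Q_n\triangleright q_n)\Rightarrow q$ with $n\ge 0$, $q,q_i$ atoms and $Q_i$ finite (possibly empty) sets of atoms. A base is a set of atomic rules; $\mathscr{C}\supseteq\mathscr{B}$ means $\mathscr{C}$ extends $\mathscr{B}$. Derivability in a base $\mathscr{B}$ (for finite sets of atoms $S$) is the least relation with: $S\cup\{q\}\vdash_{\mathscr B} q$; and if $(Q_1\triangleright q_1,\dots,Q_n\triangleright q_n)\Rightarrow q\in\mathscr B$ and $S\cup Q_i\vdash_{\mathscr B} q_i$ for all $i$, then $S\vdash_{\mathscr B} q$. The relation $\Vdash^{\ast}_{\mathscr B}$ is defined by: $\Vdash^{\ast}_{\mathscr B} p$ iff $\emptyset\vdash_{\mathscr B} p$ (atoms $p$); $\Vdash^{\ast}_{\mathscr B}\phi\to\psi$ iff $\phi\Vdash^{\ast}_{\mathscr B}\psi$; $\Vdash^{\ast}_{\mathscr B}\phi\land\psi$ iff for every $\mathscr C\supseteq\mathscr B$ and every atom $p$, if $\phi,\psi\Vdash^{\ast}_{\mathscr C} p$ then $\Vdash^{\ast}_{\mathscr C} p$; $\Vdash^{\ast}_{\mathscr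 B}\phi\lor\psi$ iff for every $\mathscr C\supseteq\mathscr B$ and every atom $p$, if $\phi\Vdash^{\ast}_{\mathscr C}p$ and $\psi\Vdash^{\ast}_{\mathscr C}p$ then $\Vdash^{\ast}_{\mathscr C}p$; $\Vdash^{\ast}_{\mathscr B}\bot$ iff $\Vdash^{\ast}_{\mathscr B}p$ for every atom $p$; for nonempty finite $\Gamma$, $\Gamma\Vdash^{\ast}_{\mathscr B}\phi$ iff for every $\mathscr C\supseteq\mathscr B$, if $\Vdash^{\ast}_{\mathscr C}\psi$ for all $\psi\in\Gamma$ then $\Vdash^{\ast}_{\mathscr C}\phi$. -}

module Defs where

open import Level using (Level; _⊔_; Lift) renaming (suc to lsuc; zero to lzero)
open import Data.Nat using (ℕ)
open import Data.List using (List; []; _∷_; _++_)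
open import Data.List.Membership.Propositional using (_∈_)
open import Data.List.Relation.Unary.All using (All)
open import Data.Product using (_×_; proj₁; proj₂)

Atom : Set
Atom = ℕ

data Formula : Set where
  atom : Atom → Formula
  ⊥̇    : Formula
  _∧̇_  : Formula → Formula → Formula
  _∨̇_  : Formula → Formula → Formula
  _⇒̇_  : Formula → Formula → Formula

-- Finite sets of atoms, represented by lists (only membership matters).
AtomSet : Set
AtomSet = List Atom

-- Atomic rule (Q₁ ▷ q₁, …, Qₙ ▷ qₙ) ⇒ q : list of premises (Qᵢ , qᵢ) and conclusion q.
record Rule : Set where
  constructor _⇒ʳ_
  field
    premises   : List (AtomSet × Atom)
    conclusion : Atom
open Rule public

Base : Set₁
Base = Rule → Set

_⊇_ : Base → Base → Set
C ⊇ B = ∀ r → B r → C r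

module Derivability (B : Base) where
  data _⊢_ : AtomSet → Atom → Set where
    ax   : ∀ {S q} → q ∈ S → S ⊢ q
    rule : ∀ {S} (r : Rule) → B r →
           All (λ Qq → (S ++ proj₁ Qq) ⊢ proj₂ Qq) (premises r) →
           S ⊢ conclusion r

_⊢[_]_ : AtomSet → Base → Atom → Set
S ⊢[ B ] q = Derivability._⊢_ B S q

-- Support ⊩*_B φ.  The clauses for →, ∧, ∨ unfold the definition of
-- Γ ⊩*_B χ for the nonempty contexts {φ} and {φ, ψ}.
⊩ : Base → Formula → Set₁
⊩ B (atom p) = Lift (lsuc lzero) ([] ⊢[ B ] p)
⊩ B ⊥̇ = ∀ p → ⊩ B (atom p)
⊩ B (φ ∧̇ ψ) = ∀ C → C ⊇ B → ∀ p →
  (∀ D → D ⊇ C → ⊩ D φ → ⊩ D ψ → ⊩ D (atom p)) → ⊩ C (atom p)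
⊩ B (φ ∨̇ ψ) = ∀ C → C ⊇ B → ∀ p →
  (∀ D → D ⊇ C → ⊩ D φ → ⊩ D (atom p)) →
  (∀ D → D ⊇ C → ⊩ D ψ → ⊩ D (atom p)) → ⊩ C (atom p)
⊩ B (φ ⇒̇ ψ) = ∀ C → C ⊇ B → ⊩ C φ → ⊩ C ψ

_⊩[_]_ : List Formula → Base → Formula → Set₁
[] ⊩[ B ] χ = ⊩ B χ
(γ ∷ Γ) ⊩[ B ] χ = ∀ C → C ⊇ B → All (⊩ C) (γ ∷ Γ) → ⊩ C χ

-- The support clause for ∧ is an elimination rule with atomic conclusions
-- only.  It extends to every conclusion χ by induction on χ: each clause of
-- support for χ is, after passing to an extension of the base, a statement
-- about atoms (for ⊥, ∧, ∨ directly; for χ₁ ⇒ χ₂ by moving to the extension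
-- supporting χ₁ and eliminating into χ₂ there).  Only the premise χ₁ needs
-- to be transported to further extensions, which is persistence of support.
module Submission where

open import Defs
open import Data.List using (List; []; _∷_; _++_)
open import Data.List.Relation.Unary.All using (All; []; _∷_)
open import Data.Product using (_×_; proj₁; proj₂)
open import Level using (lift; lower)

⊇-refl : ∀ {B} → B ⊇ B
⊇-refl r Br = Br

⊇-trans : ∀ {B C D} → D ⊇ C → C ⊇ B → D ⊇ B
⊇-trans D⊇C C⊇B r Br = D⊇C r (C⊇B r Br)

mutual
  ⊢-mono : ∀ {B C S q} → C ⊇ B → S ⊢[ B ] q → S ⊢[ C ] q
  ⊢-mono C⊇B (Derivability.ax q∈S) = Derivability.ax q∈S
  ⊢-mono C⊇B (Derivability.rule r Br ds) =
    Derivability.rule r (C⊇B r Br) (⊢-mono-All C⊇B ds)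

  ⊢-mono-All : ∀ {B C S} {ps : List (AtomSet × Atom)} → C ⊇ B →
    All (λ Qq → (S ++ proj₁ Qq) ⊢[ B ] proj₂ Qq) ps →
    All (λ Qq → (S ++ proj₁ Qq) ⊢[ C ] proj₂ Qq) ps
  ⊢-mono-All C⊇B []       = []
  ⊢-mono-All C⊇B (d ∷ ds) = ⊢-mono C⊇B d ∷ ⊢-mono-All C⊇B ds

⊩-mono : ∀ {B C} (χ : Formula) → C ⊇ B → ⊩ B χ → ⊩ C χ
⊩-mono (atom p)  C⊇B ⊩p = lift (⊢-mono C⊇B (lower ⊩p))
⊩-mono ⊥̇         C⊇B ⊩⊥ p = ⊩-mono (atom p) C⊇B (⊩⊥ p)
⊩-mono (_ ∧̇ _)   C⊇B ⊩χ D D⊇C = ⊩χ D (⊇-trans D⊇C C⊇B)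
⊩-mono (_ ∨̇ _)   C⊇B ⊩χ D D⊇C = ⊩χ D (⊇-trans D⊇C C⊇B)
⊩-mono (_ ⇒̇ _)   C⊇B ⊩χ D D⊇C = ⊩χ D (⊇-trans D⊇C C⊇B)

Eliminable : (Base → Set₁) → Base → Set₁
Eliminable P B = ∀ C → C ⊇ B → ∀ p →
  (∀ D → D ⊇ C → P D → ⊩ D (atom p)) → ⊩ C (atom p)

Eliminable-⊇ : ∀ {P B C} → C ⊇ B → Eliminable P B → Eliminable P C
Eliminable-⊇ C⊇B elim D D⊇C = elim D (⊇-trans D⊇C C⊇B)

⊩-∧-eliminable : ∀ {B} φ ψ → ⊩ B (φ ∧̇ ψ) → Eliminable (λ D → All (⊩ D) (φ ∷ ψ ∷ [])) B
⊩-∧-eliminable φ ψ ⊩φ∧ψ C C⊇B p k = ⊩φ∧ψ C C⊇B p (λ D D⊇C ⊩φ ⊩ψ → k D D⊇C (⊩φ ∷ ⊩ψ ∷ []))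

eliminate : ∀ {P B} (χ : Formula) → Eliminable P B →
  (∀ C → C ⊇ B → P C → ⊩ C χ) → ⊩ B χ
eliminate (atom p) elim h = elim _ ⊇-refl p h
eliminate ⊥̇ elim h p = elim _ ⊇-refl p (λ D D⊇B PD → h D D⊇B PD p)
eliminate (χ₁ ∧̇ χ₂) elim h C C⊇B p k =
  elim C C⊇B p (λ D D⊇C PD →
    h D (⊇-trans D⊇C C⊇B) PD D ⊇-refl p (λ E E⊇D → k E (⊇-trans E⊇D D⊇C)))
eliminate (χ₁ ∨̇ χ₂) elim h C C⊇B p k₁ k₂ =
  elim C C⊇B p (λ D D⊇C PD →
    h D (⊇-trans D⊇C C⊇B) PD D ⊇-refl p
      (λ E E⊇D → k₁ E (⊇-trans E⊇D D⊇C))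
      (λ E E⊇D → k₂ E (⊇-trans E⊇D D⊇C)))
eliminate (χ₁ ⇒̇ χ₂) elim h C C⊇B ⊩χ₁ =
  eliminate χ₂ (Eliminable-⊇ C⊇B elim) (λ D D⊇C PD →
    h D (⊇-trans D⊇C C⊇B) PD D ⊇-refl (⊩-mono χ₁ D⊇C ⊩χ₁))

lemma4 : (B : Base) (φ ψ χ : Formula) → ⊩ B (φ ∧̇ ψ) → (φ ∷ ψ ∷ []) ⊩[ B ] χ → ⊩ B χ
lemma4 B φ ψ χ ⊩φ∧ψ φ,ψ⊩χ = eliminate χ (⊩-∧-eliminable φ ψ ⊩φ∧ψ) φ,ψ⊩χ
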